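{- Suppose that the following holds for every $n \ge 1$: for every maximal intersecting subfamily $\mathcal{F}$ of $\mathcal{P}([n])$ there exist non-negative reals $(c_a)_{a \in [n]}$ with $\sum_{a \in [n]} c_a = 1$ and non-negative reals $(\lambda_{(A,B)})_{A \subseteq B \subseteq [n]}$ such that \[ \overline{\mathcal{F}} = \sum_{a \in [n]} c_a \, \overline{\mathcal{S}_a(\mathcal{P}([n]))} + \sum_{A \subseteq B \subseteq [n]} \lambda_{(A,B)} (e_B - e_A). \] Then for every $n \ge 1$ and every subset-closed family $\mathcal{G} \subseteq \mathcal{P}([n])$, amongst the largest intersecting subfamilies of $\mathcal{G}$ there is a star $\mathcal{S}_a(\mathcal{G})$ for some $a \in [n]$.
   Context: $[n] = \{1,\dots,n\}$ and $\mathcal{P}([n])$ is the power set of $[n]$; complements $A^c$ are taken in $[n]$. A family $\mathcal{F}$ of sets is intersecting if $A \cap B \neq \emptyset$ for all $A, B \in \mathcal{F}$; a maximal intersecting subfamily of $\mathcal{P}([n])$ is an intersecting family $\mathcal{F} \subseteq \mathcal{P}([n])$ not properly contained in another intersecting subfamily of $\mathcal{P}([n])$. A family $\mathcal{G}$ is subset-closed if $B \subseteq A \in \mathcal{G}$ implies $B \in \mathcal{G}$. For a family $\mathcal{F}$ and $a \in [n]$, the star centered on $a$ is $\mathcal{S}_a(\mathcal{F}) = \{A \in \mathcal{F} : a \in A\}$. For $\mathcal{F} \subseteq \mathcal{P}([n])$, its embedding $\overline{\mathcal{F}} \in \mathbb{R}^{\mathcal{P}([n])}$ is $\overline{\mathcal{F}}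 = \sum_{A \subseteq [n]} \epsilon_A e_A$, where $(e_A)_{A\subseteq[n]}$ is the standard basis and $\epsilon_A = +1$ if $A \in \mathcal{F}$ and $A^c \notin \mathcal{F}$, $\epsilon_A = -1$ if $A \notin \mathcal{F}$ and $A^c \in \mathcal{F}$, and $\epsilon_A = 0$ otherwise.
   Formalization: The coefficients $c_a$ and $\lambda_{(A,B)}$ in the assumed decomposition of $\overline{\mathcal{F}}$ are non-negative rationals rather than non-negative reals. -}

module Defs where

open import Data.Bool using (Bool; true; false; _∧_; not; if_then_else_)
open import Data.Nat using (ℕ; zero; suc)
open import Data.Fin using (Fin)
open import Data.Fin.Subset using (Subset; inside; outside; _∩_; ∁; Nonempty; _⊆_)
open import Data.Fin.Subset.Properties using (_⊆?_)
open import Data.List using (List; []; _∷_; map; _++_; foldr; filter; length; allFin)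
open import Data.Vec using (_∷_; []; lookup)
open import Data.Vec.Properties using (≡-dec)
import Data.Bool.Properties as BoolP
open import Data.Rational using (ℚ; 0ℚ; 1ℚ; _+_; _*_; _-_; -_; _≤_)
open import Data.Product using (Σ; ∃; _×_)
open import Relation.Nullary using (yes; no; Dec)
open import Relation.Binary.PropositionalEquality using (_≡_)

allSubsets : ∀ n → List (Subset n)
allSubsets zero = [] ∷ []
allSubsets (suc n) = map (outside ∷_) (allSubsets n) ++ map (inside ∷_) (allSubsets n)

_≟ₛ_ : ∀ {n} (A B : Subset n) → Dec (A ≡ B)
_≟ₛ_ = ≡-dec BoolP._≟_

Family : ℕ → Set
Family n = Subset n → Bool

_⊆ᶠ_ : ∀ {n} → Family n → Family n → Set
F ⊆ᶠ G = ∀ A → F A ≡ true → G A ≡ true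

∣_∣ᶠ : ∀ {n} → Family n → ℕ
∣_∣ᶠ {n} F = length (filter (λ A → F A BoolP.≟ true) (allSubsets n))

Intersecting : ∀ {n} → Family n → Set
Intersecting F = ∀ A B → F A ≡ true → F B ≡ true → Nonempty (A ∩ B)

MaximalIntersecting : ∀ {n} → Family n → Set
MaximalIntersecting {n} F =
  Intersecting F × (∀ (H : Family n) → Intersecting H → F ⊆ᶠ H → H ⊆ᶠ F)

SubsetClosed : ∀ {n} → Family n → Set
SubsetClosed G = ∀ A B → B ⊆ A → G A ≡ true → G B ≡ true

star : ∀ {n} → Fin n → Family n → Family n
star a F A = F A ∧ lookup A a

powerSet : ∀ {n} → Family n
powerSet _ = true

Vector : ℕ → Set
Vector n = Subset n → ℚ

embed : ∀ {n} → Family n → Vector n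
embed F A with F A | F (∁ A)
... | true  | false = 1ℚ
... | false | true  = - 1ℚ
... | _     | _     = 0ℚ

e : ∀ {n} → Subset n → Vector n
e B C with B ≟ₛ C
... | yes _ = 1ℚ
... | no  _ = 0ℚ

sumList : ∀ {X : Set} → List X → (X → ℚ) → ℚ
sumList xs f = foldr (λ x acc → f x + acc) 0ℚ xs

sumFin : ∀ n → (Fin n → ℚ) → ℚ
sumFin n f = sumList (allFin n) f

sumSub : ∀ n → (Subset n → ℚ) → ℚ
sumSub n f = sumList (allSubsets n) f

sumPairs : ∀ n → (Subset n → Subset n → ℚ) → ℚ
sumPairs n f = sumSub n (λ A → sumSub n (λ B → if ⌊ A ⊆? B ⌋' then f A B else 0ℚ))
  where
  ⌊_⌋' : ∀ {P : Set} → Dec P → Bool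
  ⌊ yes _ ⌋' = true
  ⌊ no  _ ⌋' = false

Decomposable : ∀ {n} → Family n → Set
Decomposable {n} F =
  Σ (Fin n → ℚ) λ c → Σ (Subset n → Subset n → ℚ) λ lam →
    (∀ a → 0ℚ ≤ c a) × (sumFin n c ≡ 1ℚ) ×
    (∀ A B → A ⊆ B → 0ℚ ≤ lam A B) ×
    (∀ C → embed F C ≡
       sumFin n (λ a → c a * embed (star a powerSet) C)
       + sumPairs n (λ A B → lam A B * (e B C - e A C)))

{-# OPTIONS --safe #-}
-- Pair the decomposition of a maximal intersecting family F with the indicator vector g of G.
-- As G is subset-closed, g is antitone, so each term λ (e_B − e_A) with A ⊆ B contributes
-- λ (g B − g A) ≤ 0, while the stars contribute a convex combination of the numbers
-- ⟨g, S̄_a⟩ = 2 |S_a(G)| − |G|; hence ⟨g, F̄⟩ ≤ 2 |S_a(G)| − |G| for the best star a.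
-- Conversely, if H ⊆ G is intersecting and F is a maximal intersecting family containing H
-- (built greedily), each member of H contributes +1 to ⟨g, F̄⟩ and each other member of G at
-- least −1, so 2 |H| − |G| ≤ ⟨g, F̄⟩. Together, |H| ≤ |S_a(G)|.
module Submission where

open import Defs
open import Algebra.Bundles using (CommutativeMonoid)
open import Data.Bool using (Bool; true; false; _∨_; not; if_then_else_)
open import Data.Bool.Properties using (∨-zeroʳ) renaming (_≟_ to _≟ᵇ_)
open import Data.Fin as Fin using (Fin)
open import Data.Fin.Subset using (Subset; inside; outside; ∁; _∩_; _⊆_; Empty) renaming (_∈_ to _∈ₛ_)
open import Data.Fin.Subset.Properties using (_⊆?_; nonempty?; anySubset?; ∩-inverseʳ; ∉⊥; x∈p∩q⁺)
open import Data.List using (List; []; _∷_; map; _++_; filter; length; allFin)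
open import Data.List.Membership.Propositional using (_∈_)
open import Data.List.Membership.Propositional.Properties using (∈-++⁺ˡ; ∈-++⁺ʳ; ∈-map⁺; ∈-allFin)
open import Data.List.Properties using (foldr-cong)
import Data.List.Relation.Unary.All as All
open import Data.List.Relation.Unary.Any using (here; there)
open import Data.Nat as ℕ using (ℕ; suc; z≤n; s≤s)
import Data.Nat.Properties as ℕP
open import Data.Product using (Σ; _×_; _,_; proj₁; proj₂)
open import Data.Rational using (ℚ; 0ℚ; 1ℚ; _+_; _*_; _-_; -_; _≤_; _<_; nonNegative)
import Data.Rational.Properties as ℚP
open import Data.Vec using (_∷_; []; lookup)
open import Data.Vec.Properties using (lookup-map; lookup⇒[]=; ∷-injective)
open import Function using (_∘_)
open import Relation.Binary.Bundles using (DecTotalOrder)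
open import Relation.Binary.PropositionalEquality
open import Relation.Nullary using (Dec; yes; no; does; contradiction)
open import Relation.Nullary.Decidable using (True; toWitness; ¬?; _→-dec_; decidable-stable)

open import Algebra.Properties.CommutativeSemigroup
  (CommutativeMonoid.commutativeSemigroup ℚP.+-0-commutativeMonoid)
  using () renaming (interchange to +-interchange)
open import Algebra.Properties.CommutativeSemigroup
  (CommutativeMonoid.commutativeSemigroup ℚP.*-1-commutativeMonoid)
  using () renaming (x∙yz≈y∙xz to *-leftComm)
open import Data.List.Extrema (DecTotalOrder.totalOrder ℚP.≤-decTotalOrder) using (argmax; f[xs]≤f[argmax])

≤-by-evaluation : ∀ {p q : ℚ} {_ : True (p ℚP.≤? q)} → p ≤ q
≤-by-evaluation {p} {q} {p≤q} = toWitness p≤q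

p≤q⇒p-q≤0 : ∀ {p q} → p ≤ q → p - q ≤ 0ℚ
p≤q⇒p-q≤0 {p} {q} p≤q = subst (p - q ≤_) (ℚP.+-inverseʳ q) (ℚP.+-monoˡ-≤ (- q) p≤q)

p<1+p : ∀ p → p < 1ℚ + p
p<1+p p = subst (_< 1ℚ + p) (ℚP.+-identityˡ p) (ℚP.+-monoˡ-< p (ℚP.positive⁻¹ 1ℚ))

+-double-cancel-≤ : ∀ {p q} → p + p ≤ q + q → p ≤ q
+-double-cancel-≤ p+p≤q+q =
  ℚP.≮⇒≥ (λ q<p → ℚP.<-irrefl refl (ℚP.<-≤-trans (ℚP.+-mono-< q<p q<p) p+p≤q+q))

fromBool : Bool → ℚ
fromBool true  = 1ℚ
fromBool false = 0ℚ

fromBool-nonNeg : ∀ b → 0ℚ ≤ fromBool b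
fromBool-nonNeg true  = ≤-by-evaluation
fromBool-nonNeg false = ℚP.≤-refl

fromBool-*-+-nonNeg : ∀ b {v} → - 1ℚ ≤ v → 0ℚ ≤ fromBool b * v + fromBool b
fromBool-*-+-nonNeg true  {v} v≥-1 =
  subst (0ℚ ≤_) (cong (_+ 1ℚ) (sym (ℚP.*-identityˡ v))) (ℚP.+-monoˡ-≤ 1ℚ v≥-1)
fromBool-*-+-nonNeg false {v} _    = ℚP.≤-reflexive (sym (trans (ℚP.+-identityʳ _) (ℚP.*-zeroˡ v)))

fromℕ : ℕ → ℚ
fromℕ ℕ.zero  = 0ℚ
fromℕ (suc k) = 1ℚ + fromℕ k

fromℕ-mono-≤ : ∀ {m n} → m ℕ.≤ n → fromℕ m ≤ fromℕ n
fromℕ-mono-≤ {n = ℕ.zero} z≤n       = ℚP.≤-refl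
fromℕ-mono-≤ {n = suc n}  z≤n       = ℚP.+-mono-≤ (≤-by-evaluation {0ℚ} {1ℚ}) (fromℕ-mono-≤ {n = n} z≤n)
fromℕ-mono-≤              (s≤s m≤n) = ℚP.+-monoʳ-≤ 1ℚ (fromℕ-mono-≤ m≤n)

fromℕ-mono-< : ∀ {m n} → m ℕ.< n → fromℕ m < fromℕ n
fromℕ-mono-< {m} (s≤s m≤n) = ℚP.<-≤-trans (p<1+p (fromℕ m)) (ℚP.+-monoʳ-≤ 1ℚ (fromℕ-mono-≤ m≤n))

fromℕ-cancel-≤ : ∀ {m n} → fromℕ m ≤ fromℕ n → m ℕ.≤ n
fromℕ-cancel-≤ m≤n = ℕP.≮⇒≥ (λ n<m → ℚP.<-irrefl refl (ℚP.<-≤-trans (fromℕ-mono-< n<m) m≤n))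

module _ {X : Set} where

  sum-cong : ∀ xs {f g : X → ℚ} → (∀ x → f x ≡ g x) → sumList xs f ≡ sumList xs g
  sum-cong []       f≗g = refl
  sum-cong (x ∷ xs) f≗g = cong₂ _+_ (f≗g x) (sum-cong xs f≗g)

  sum-zero : ∀ xs → sumList xs (λ (_ : X) → 0ℚ) ≡ 0ℚ
  sum-zero []       = refl
  sum-zero (x ∷ xs) = trans (cong (0ℚ +_) (sum-zero xs)) (ℚP.+-identityˡ 0ℚ)

  sum-+ : ∀ xs (f g : X → ℚ) → sumList xs (λ x → f x + g x) ≡ sumList xs f + sumList xs g
  sum-+ []       f g = sym (ℚP.+-identityˡ 0ℚ)
  sum-+ (x ∷ xs) f g = trans (cong (f x + g x +_) (sum-+ xs f g)) (+-interchange (f x) (g x) _ _)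

  sum-*ˡ : ∀ xs k (f : X → ℚ) → sumList xs (λ x → k * f x) ≡ k * sumList xs f
  sum-*ˡ []       k f = sym (ℚP.*-zeroʳ k)
  sum-*ˡ (x ∷ xs) k f = trans (cong (k * f x +_) (sum-*ˡ xs k f)) (sym (ℚP.*-distribˡ-+ k (f x) _))

  sum-neg : ∀ xs (f : X → ℚ) → sumList xs (λ x → - f x) ≡ - sumList xs f
  sum-neg []       f = refl
  sum-neg (x ∷ xs) f = trans (cong (- f x +_) (sum-neg xs f)) (sym (ℚP.neg-distrib-+ (f x) _))

  sum-++ : ∀ xs ys (f : X → ℚ) → sumList (xs ++ ys) f ≡ sumList xs f + sumList ys f
  sum-++ []       ys f = sym (ℚP.+-identityˡ _)
  sum-++ (x ∷ xs) ys f = trans (cong (f x +_) (sum-++ xs ys f)) (sym (ℚP.+-assoc (f x) _ _))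

  sum-mono-≤ : ∀ xs {f g : X → ℚ} → (∀ x → f x ≤ g x) → sumList xs f ≤ sumList xs g
  sum-mono-≤ []       f≤g = ℚP.≤-refl
  sum-mono-≤ (x ∷ xs) f≤g = ℚP.+-mono-≤ (f≤g x) (sum-mono-≤ xs f≤g)

  sum-nonpos : ∀ xs {f : X → ℚ} → (∀ x → f x ≤ 0ℚ) → sumList xs f ≤ 0ℚ
  sum-nonpos xs {f} f≤0 = subst (sumList xs f ≤_) (sum-zero xs) (sum-mono-≤ xs f≤0)

  sum-fromBool : ∀ xs (p : X → Bool) →
                 sumList xs (fromBool ∘ p) ≡ fromℕ (length (filter (λ x → p x ≟ᵇ true) xs))
  sum-fromBool []       p = refl
  sum-fromBool (x ∷ xs) p with p x
  ... | true  = cong (1ℚ +_) (sum-fromBool xs p)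
  ... | false = trans (ℚP.+-identityˡ _) (sum-fromBool xs p)

  sum-convex-≤ : ∀ xs {c y : X → ℚ} {M} → (∀ x → 0ℚ ≤ c x) → sumList xs c ≡ 1ℚ →
                 (∀ x → y x ≤ M) → sumList xs (λ x → c x * y x) ≤ M
  sum-convex-≤ xs {c} {y} {M} c≥0 Σc≡1 y≤M = begin
    sumList xs (λ x → c x * y x)
      ≤⟨ sum-mono-≤ xs (λ x → ℚP.*-monoˡ-≤-nonNeg (c x) {{nonNegative (c≥0 x)}} (y≤M x)) ⟩
    sumList xs (λ x → c x * M)   ≡⟨ sum-cong xs (λ x → ℚP.*-comm (c x) M) ⟩
    sumList xs (λ x → M * c x)   ≡⟨ sum-*ˡ xs M c ⟩
    M * sumList xs c             ≡⟨ cong (M *_) Σc≡1 ⟩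
    M * 1ℚ                       ≡⟨ ℚP.*-identityʳ M ⟩
    M                            ∎
    where open ℚP.≤-Reasoning

sum-map : ∀ {X Y : Set} xs (h : X → Y) (f : Y → ℚ) → sumList (map h xs) f ≡ sumList xs (f ∘ h)
sum-map []       h f = refl
sum-map (x ∷ xs) h f = cong (f (h x) +_) (sum-map xs h f)

sum-comm : ∀ {X Y : Set} xs ys (f : X → Y → ℚ) →
           sumList xs (λ x → sumList ys (f x)) ≡ sumList ys (λ y → sumList xs (λ x → f x y))
sum-comm []       ys f = sym (sum-zero ys)
sum-comm (x ∷ xs) ys f = trans (cong (sumList ys (f x) +_) (sum-comm xs ys f)) (sym (sum-+ ys (f x) _))

∈-allSubsets : ∀ {n} (A : Subset n) → A ∈ allSubsets n
∈-allSubsets {ℕ.zero} []            = here refl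
∈-allSubsets {suc n}  (outside ∷ A) = ∈-++⁺ˡ (∈-map⁺ (outside ∷_) (∈-allSubsets A))
∈-allSubsets {suc n}  (inside ∷ A)  = ∈-++⁺ʳ _ (∈-map⁺ (inside ∷_) (∈-allSubsets A))

sumSub-suc : ∀ n (f : Subset (suc n) → ℚ) →
             sumSub (suc n) f ≡ sumSub n (λ C → f (outside ∷ C)) + sumSub n (λ C → f (inside ∷ C))
sumSub-suc n f = trans (sum-++ (map (outside ∷_) Cs) _ f) (cong₂ _+_ (sum-map Cs _ f) (sum-map Cs _ f))
  where Cs = allSubsets n

-- The summands of sumPairs are guarded by a function local to Defs, which cannot be named here,
-- so the left-hand side of sumPairs-summand is left for Agda to infer from its use in
-- sumPairs-does, where foldr-cong exposes it as a whole fold step.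
mutual
  sumPairs-does : ∀ n (f : Subset n → Subset n → ℚ) →
                  sumPairs n f ≡ sumSub n (λ A → sumSub n (λ B → if does (A ⊆? B) then f A B else 0ℚ))
  sumPairs-does n f = foldr-cong
    (λ A acc → cong (_+ acc) (foldr-cong (sumPairs-summand n f A) refl (allSubsets n))) refl (allSubsets n)

  sumPairs-summand : ∀ n (f : Subset n → Subset n → ℚ) A B acc →
                     _ ≡ (if does (A ⊆? B) then f A B else 0ℚ) + acc
  sumPairs-summand n f A B acc with A ⊆? B
  ... | yes _ = refl
  ... | no  _ = refl

guarded-nonpos : ∀ {P : Set} (d : Dec P) {x} → (P → x ≤ 0ℚ) → (if does d then x else 0ℚ) ≤ 0ℚ
guarded-nonpos (yes p) x≤0 = x≤0 p
guarded-nonpos (no _)  x≤0 = ℚP.≤-refl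

sumPairs-nonpos : ∀ n {f : Subset n → Subset n → ℚ} → (∀ {A B} → A ⊆ B → f A B ≤ 0ℚ) → sumPairs n f ≤ 0ℚ
sumPairs-nonpos n f≤0 = subst (_≤ 0ℚ) (sym (sumPairs-does n _))
  (sum-nonpos (allSubsets n) (λ A → sum-nonpos (allSubsets n) (λ B → guarded-nonpos (A ⊆? B) f≤0)))

e-diag : ∀ {n} (B : Subset n) → e B B ≡ 1ℚ
e-diag B with B ≟ₛ B
... | yes _   = refl
... | no  B≢B = contradiction refl B≢B

e-offdiag : ∀ {n} (B C : Subset n) → B ≢ C → e B C ≡ 0ℚ
e-offdiag B C B≢C with B ≟ₛ C
... | yes B≡C = contradiction B≡C B≢C
... | no  _   = refl

e-∷ : ∀ {n} x (B C : Subset n) → e (x ∷ B) (x ∷ C) ≡ e B C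
e-∷ x B C = by-cases (B ≟ₛ C)
  where
  by-cases : Dec (B ≡ C) → e (x ∷ B) (x ∷ C) ≡ e B C
  by-cases (yes refl) = trans (e-diag (x ∷ B)) (sym (e-diag B))
  by-cases (no B≢C)   =
    trans (e-offdiag (x ∷ B) (x ∷ C) (B≢C ∘ proj₂ ∘ ∷-injective)) (sym (e-offdiag B C B≢C))

e-∷-≢ : ∀ {n} {x y} (B C : Subset n) → x ≢ y → e (x ∷ B) (y ∷ C) ≡ 0ℚ
e-∷-≢ B C x≢y = e-offdiag _ _ (x≢y ∘ proj₁ ∘ ∷-injective)

infix 7 _·_

_·_ : ∀ {n} → Vector n → Vector n → ℚ
_·_ {n} w v = sumSub n (λ C → w C * v C)

module _ {n} (w : Vector n) where

  ·-cong : ∀ {u v : Vector n} → (∀ C → u C ≡ v C) → w · u ≡ w · v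
  ·-cong u≗v = sum-cong (allSubsets n) (λ C → cong (w C *_) (u≗v C))

  ·-+ : ∀ (u v : Vector n) → w · (λ C → u C + v C) ≡ w · u + w · v
  ·-+ u v = trans (sum-cong (allSubsets n) (λ C → ℚP.*-distribˡ-+ (w C) (u C) (v C)))
                  (sum-+ (allSubsets n) (λ C → w C * u C) (λ C → w C * v C))

  ·-neg : ∀ (v : Vector n) → w · (λ C → - v C) ≡ - (w · v)
  ·-neg v = trans (sum-cong (allSubsets n) (λ C → sym (ℚP.neg-distribʳ-* (w C) (v C))))
                  (sum-neg (allSubsets n) (λ C → w C * v C))

  ·-*ˡ : ∀ k (v : Vector n) → w · (λ C → k * v C) ≡ k * (w · v)
  ·-*ˡ k v = trans (sum-cong (allSubsets n) (λ C → *-leftComm (w C) k (v C)))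
                   (sum-*ˡ (allSubsets n) k (λ C → w C * v C))

  ·-zero : w · (λ _ → 0ℚ) ≡ 0ℚ
  ·-zero = trans (sum-cong (allSubsets n) (λ C → ℚP.*-zeroʳ (w C))) (sum-zero (allSubsets n))

  ·-if : ∀ b (v : Vector n) → w · (λ C → if b then v C else 0ℚ) ≡ (if b then w · v else 0ℚ)
  ·-if true  v = refl
  ·-if false v = ·-zero

  ·-sum : ∀ {X : Set} xs (f : X → Vector n) →
          w · (λ C → sumList xs (λ x → f x C)) ≡ sumList xs (λ x → w · f x)
  ·-sum xs f = trans (sum-cong (allSubsets n) (λ C → sym (sum-*ˡ xs (w C) (λ x → f x C))))
                     (sum-comm (allSubsets n) xs (λ C x → w C * f x C))

  ·-sumPairs : ∀ (f : Subset n → Subset n → Vector n) →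
               w · (λ C → sumPairs n (λ A B → f A B C)) ≡ sumPairs n (λ A B → w · f A B)
  ·-sumPairs f = begin
    w · (λ C → sumPairs n (λ A B → f A B C))
      ≡⟨ ·-cong (λ C → sumPairs-does n (λ A B → f A B C)) ⟩
    w · (λ C → sumSub n (λ A → sumSub n (λ B → if does (A ⊆? B) then f A B C else 0ℚ)))
      ≡⟨ ·-sum (allSubsets n) _ ⟩
    sumSub n (λ A → w · (λ C → sumSub n (λ B → if does (A ⊆? B) then f A B C else 0ℚ)))
      ≡⟨ sum-cong (allSubsets n) (λ A → trans (·-sum (allSubsets n) _)
                                              (sum-cong (allSubsets n) (λ B → ·-if (does (A ⊆? B)) (f A B)))) ⟩
    sumSub n (λ A → sumSub n (λ B → if does (A ⊆? B) then w · f A B else 0ℚ))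
      ≡⟨ sumPairs-does n _ ⟨
    sumPairs n (λ A B → w · f A B) ∎
    where open ≡-Reasoning

module _ {n} (w : Vector (suc n)) (x : Bool) (B : Subset n) where

  ·-e-on-head : sumSub n (λ C → w (x ∷ C) * e (x ∷ B) (x ∷ C)) ≡ (λ C → w (x ∷ C)) · e B
  ·-e-on-head = sum-cong (allSubsets n) (λ C → cong (w (x ∷ C) *_) (e-∷ x B C))

  ·-e-off-head : ∀ {y} → x ≢ y → sumSub n (λ C → w (y ∷ C) * e (x ∷ B) (y ∷ C)) ≡ 0ℚ
  ·-e-off-head {y} x≢y = trans (sum-cong (allSubsets n) (λ C → cong (w (y ∷ C) *_) (e-∷-≢ B C x≢y)))
                               (·-zero (λ C → w (y ∷ C)))

·-e : ∀ {n} (w : Vector n) (B : Subset n) → w · e B ≡ w B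
·-e {ℕ.zero} w [] = trans (ℚP.+-identityʳ _) (ℚP.*-identityʳ (w []))
·-e {suc n}  w (outside ∷ B) = begin
  w · e (outside ∷ B)
    ≡⟨ sumSub-suc n (λ C → w C * e (outside ∷ B) C) ⟩
  sumSub n (λ C → w (outside ∷ C) * e (outside ∷ B) (outside ∷ C))
    + sumSub n (λ C → w (inside ∷ C) * e (outside ∷ B) (inside ∷ C))
    ≡⟨ cong₂ _+_ (trans (·-e-on-head w outside B) (·-e (λ C → w (outside ∷ C)) B))
                 (·-e-off-head w outside B (λ ())) ⟩
  w (outside ∷ B) + 0ℚ
    ≡⟨ ℚP.+-identityʳ _ ⟩
  w (outside ∷ B) ∎
  where open ≡-Reasoning
·-e {suc n}  w (inside ∷ B) = begin
  w · e (inside ∷ B)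
    ≡⟨ sumSub-suc n (λ C → w C * e (inside ∷ B) C) ⟩
  sumSub n (λ C → w (outside ∷ C) * e (inside ∷ B) (outside ∷ C))
    + sumSub n (λ C → w (inside ∷ C) * e (inside ∷ B) (inside ∷ C))
    ≡⟨ cong₂ _+_ (·-e-off-head w inside B (λ ()))
                 (trans (·-e-on-head w inside B) (·-e (λ C → w (inside ∷ C)) B)) ⟩
  0ℚ + w (inside ∷ B)
    ≡⟨ ℚP.+-identityˡ _ ⟩
  w (inside ∷ B) ∎
  where open ≡-Reasoning

·-basis-difference : ∀ {n} (w : Vector n) k (B A : Subset n) →
                     w · (λ C → k * (e B C - e A C)) ≡ k * (w B - w A)
·-basis-difference w k B A = begin
  w · (λ C → k * (e B C - e A C))     ≡⟨ ·-*ˡ w k (λ C → e B C - e A C) ⟩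
  k * (w · (λ C → e B C - e A C))     ≡⟨ cong (k *_) (·-+ w (e B) (λ C → - e A C)) ⟩
  k * (w · e B + w · (λ C → - e A C)) ≡⟨ cong (λ z → k * (w · e B + z)) (·-neg w (e A)) ⟩
  k * (w · e B - w · e A)             ≡⟨ cong₂ (λ x y → k * (x - y)) (·-e w B) (·-e w A) ⟩
  k * (w B - w A)                     ∎
  where open ≡-Reasoning

Antitone : ∀ {n} → Vector n → Set
Antitone {n} w = ∀ {A B : Subset n} → A ⊆ B → w B ≤ w A

·-pairs-nonpos : ∀ {n} {w : Vector n} {lam : Subset n → Subset n → ℚ} → Antitone w →
                 (∀ A B → A ⊆ B → 0ℚ ≤ lam A B) →
                 w · (λ C → sumPairs n (λ A B → lam A B * (e B C - e A C))) ≤ 0ℚ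
·-pairs-nonpos {n} {w} {lam} w-antitone lam≥0 = begin
  w · (λ C → sumPairs n (λ A B → lam A B * (e B C - e A C)))
    ≡⟨ ·-sumPairs w (λ A B C → lam A B * (e B C - e A C)) ⟩
  sumPairs n (λ A B → w · (λ C → lam A B * (e B C - e A C)))
    ≤⟨ sumPairs-nonpos n pair-nonpos ⟩
  0ℚ ∎
  where
  open ℚP.≤-Reasoning
  pair-nonpos : ∀ {A B} → A ⊆ B → w · (λ C → lam A B * (e B C - e A C)) ≤ 0ℚ
  pair-nonpos {A} {B} A⊆B = begin
    w · (λ C → lam A B * (e B C - e A C))
      ≡⟨ ·-basis-difference w (lam A B) B A ⟩
    lam A B * (w B - w A)
      ≤⟨ ℚP.*-monoˡ-≤-nonNeg (lam A B) {{nonNegative (lam≥0 A B A⊆B)}} (p≤q⇒p-q≤0 (w-antitone A⊆B)) ⟩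
    lam A B * 0ℚ
      ≡⟨ ℚP.*-zeroʳ (lam A B) ⟩
    0ℚ ∎

·-embed-≤ : ∀ {n} {w : Vector n} {F : Family n} {M} → Antitone w → Decomposable F →
            (∀ a → w · embed (star a powerSet) ≤ M) → w · embed F ≤ M
·-embed-≤ {n} {w} {F} {M} w-antitone (c , lam , c≥0 , Σc≡1 , lam≥0 , F̄≡) stars≤M = begin
  w · embed F                    ≡⟨ ·-cong w F̄≡ ⟩
  w · (λ C → stars C + pairs C)  ≡⟨ ·-+ w stars pairs ⟩
  w · stars + w · pairs          ≤⟨ ℚP.+-mono-≤ stars-bound (·-pairs-nonpos w-antitone lam≥0) ⟩
  M + 0ℚ                         ≡⟨ ℚP.+-identityʳ M ⟩
  M                              ∎
  where
  open ℚP.≤-Reasoning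
  stars pairs : Vector n
  stars C = sumFin n (λ a → c a * embed (star a powerSet) C)
  pairs C = sumPairs n (λ A B → lam A B * (e B C - e A C))
  stars-bound : w · stars ≤ M
  stars-bound = begin
    w · stars
      ≡⟨ ·-sum w (allFin n) (λ a C → c a * embed (star a powerSet) C) ⟩
    sumFin n (λ a → w · (λ C → c a * embed (star a powerSet) C))
      ≡⟨ sum-cong (allFin n) (λ a → ·-*ˡ w (c a) (embed (star a powerSet))) ⟩
    sumFin n (λ a → c a * (w · embed (star a powerSet)))
      ≤⟨ sum-convex-≤ (allFin n) c≥0 Σc≡1 stars≤M ⟩
    M ∎

χ : ∀ {n} → Family n → Vector n
χ F C = fromBool (F C)

sumSub-χ : ∀ {n} (F : Family n) → sumSub n (χ F) ≡ fromℕ ∣ F ∣ᶠ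
sumSub-χ {n} F = sum-fromBool (allSubsets n) F

χ-antitone : ∀ {n} {G : Family n} → SubsetClosed G → Antitone (χ G)
χ-antitone {G = G} G-closed {A} {B} A⊆B with G B in B∈G
... | true  rewrite G-closed B A A⊆B B∈G = ℚP.≤-refl
... | false = fromBool-nonNeg (G A)

p∩∁p-Empty : ∀ {n} (p : Subset n) → Empty (p ∩ ∁ p)
p∩∁p-Empty p (x , x∈p∩∁p) = ∉⊥ (subst (x ∈ₛ_) (∩-inverseʳ p) x∈p∩∁p)

embed-≥-1 : ∀ {n} (F : Family n) C → - 1ℚ ≤ embed F C
embed-≥-1 F C with F C | F (∁ C)
... | true  | true  = ≤-by-evaluation
... | true  | false = ≤-by-evaluation
... | false | true  = ℚP.≤-refl
... | false | false = ≤-by-evaluation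

embed-intersecting-member : ∀ {n} {F : Family n} → Intersecting F → ∀ {C} → F C ≡ true → embed F C ≡ 1ℚ
embed-intersecting-member {F = F} F-int {C} C∈F with F (∁ C) in ∁C∈F
... | true  = contradiction (F-int C (∁ C) C∈F ∁C∈F) (p∩∁p-Empty C)
... | false rewrite C∈F = refl

embed-star-powerSet : ∀ {n} (a : Fin n) C → embed (star a powerSet) C ≡ (if lookup C a then 1ℚ else - 1ℚ)
embed-star-powerSet a C rewrite lookup-map a not C with lookup C a
... | true  = refl
... | false = refl

double-count-pointwise : ∀ {n} {H G F : Family n} → H ⊆ᶠ G → H ⊆ᶠ F → Intersecting F → ∀ C →
                         χ H C + χ H C ≤ χ G C * embed F C + χ G C
double-count-pointwise {H = H} {G} {F} H⊆G H⊆F F-int C with H C in C∈H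
... | true  rewrite H⊆G C C∈H | embed-intersecting-member F-int (H⊆F C C∈H) = ℚP.≤-refl
... | false = fromBool-*-+-nonNeg (G C) (embed-≥-1 F C)

double-count-≤ : ∀ {n} {H G F : Family n} → H ⊆ᶠ G → H ⊆ᶠ F → Intersecting F →
                 fromℕ ∣ H ∣ᶠ + fromℕ ∣ H ∣ᶠ ≤ χ G · embed F + fromℕ ∣ G ∣ᶠ
double-count-≤ {n} {H} {G} {F} H⊆G H⊆F F-int = begin
  fromℕ ∣ H ∣ᶠ + fromℕ ∣ H ∣ᶠ
    ≡⟨ cong₂ _+_ (sumSub-χ H) (sumSub-χ H) ⟨
  sumSub n (χ H) + sumSub n (χ H)
    ≡⟨ sum-+ (allSubsets n) (χ H) (χ H) ⟨
  sumSub n (λ C → χ H C + χ H C)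
    ≤⟨ sum-mono-≤ (allSubsets n) (double-count-pointwise H⊆G H⊆F F-int) ⟩
  sumSub n (λ C → χ G C * embed F C + χ G C)
    ≡⟨ sum-+ (allSubsets n) (λ C → χ G C * embed F C) (χ G) ⟩
  χ G · embed F + sumSub n (χ G)
    ≡⟨ cong (χ G · embed F +_) (sumSub-χ G) ⟩
  χ G · embed F + fromℕ ∣ G ∣ᶠ ∎
  where open ℚP.≤-Reasoning

star-count-pointwise : ∀ {n} (G : Family n) a C →
                       χ G C * embed (star a powerSet) C + χ G C ≡ χ (star a G) C + χ (star a G) C
star-count-pointwise G a C rewrite embed-star-powerSet a C with G C | lookup C a
... | true  | true  = refl
... | true  | false = refl
... | false | true  = refl
... | false | false = refl

·-embed-star : ∀ {n} (G : Family n) a →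
               χ G · embed (star a powerSet) + fromℕ ∣ G ∣ᶠ ≡ fromℕ ∣ star a G ∣ᶠ + fromℕ ∣ star a G ∣ᶠ
·-embed-star {n} G a = begin
  χ G · S̄ + fromℕ ∣ G ∣ᶠ
    ≡⟨ cong (χ G · S̄ +_) (sumSub-χ G) ⟨
  χ G · S̄ + sumSub n (χ G)
    ≡⟨ sum-+ (allSubsets n) (λ C → χ G C * S̄ C) (χ G) ⟨
  sumSub n (λ C → χ G C * S̄ C + χ G C)
    ≡⟨ sum-cong (allSubsets n) (star-count-pointwise G a) ⟩
  sumSub n (λ C → χ (star a G) C + χ (star a G) C)
    ≡⟨ sum-+ (allSubsets n) (χ (star a G)) (χ (star a G)) ⟩
  sumSub n (χ (star a G)) + sumSub n (χ (star a G))
    ≡⟨ cong₂ _+_ (sumSub-χ (star a G)) (sumSub-χ (star a G)) ⟩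
  fromℕ ∣ star a G ∣ᶠ + fromℕ ∣ star a G ∣ᶠ ∎
  where
  open ≡-Reasoning
  S̄ = embed (star a powerSet)

allSubsets? : ∀ {n} {P : Subset n → Set} → (∀ A → Dec (P A)) → Dec (∀ A → P A)
allSubsets? P? with anySubset? (¬? ∘ P?)
... | yes (A , ¬PA) = no (λ ∀P → ¬PA (∀P A))
... | no  ∄¬P       = yes (λ A → decidable-stable (P? A) (∄¬P ∘ (A ,_)))

intersecting? : ∀ {n} (F : Family n) → Dec (Intersecting F)
intersecting? F =
  allSubsets? λ A → allSubsets? λ B → (F A ≟ᵇ true) →-dec (F B ≟ᵇ true) →-dec nonempty? (A ∩ B)

⊆ᶠ-trans : ∀ {n} {F G H : Family n} → F ⊆ᶠ G → G ⊆ᶠ H → F ⊆ᶠ H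
⊆ᶠ-trans F⊆G G⊆H X = G⊆H X ∘ F⊆G X

intersecting-⊆ᶠ : ∀ {n} {F H : Family n} → F ⊆ᶠ H → Intersecting H → Intersecting F
intersecting-⊆ᶠ F⊆H H-int A B A∈F B∈F = H-int A B (F⊆H A A∈F) (F⊆H B B∈F)

insert : ∀ {n} → Subset n → Family n → Family n
insert A F X = F X ∨ does (X ≟ₛ A)

insert-⊇ : ∀ {n} A (F : Family n) → F ⊆ᶠ insert A F
insert-⊇ A F X X∈F rewrite X∈F = refl

insert-∋ : ∀ {n} A (F : Family n) → insert A F A ≡ true
insert-∋ A F with A ≟ₛ A
... | yes _   = ∨-zeroʳ (F A)
... | no  A≢A = contradiction refl A≢A

insert-least : ∀ {n} {A} {F H : Family n} → F ⊆ᶠ H → H A ≡ true → insert A F ⊆ᶠ H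
insert-least {A = A} {F} F⊆H A∈H X X∈ with F X in X∈F | X ≟ₛ A
... | true  | _        = F⊆H X X∈F
... | false | yes refl = A∈H
... | false | no  _    = contradiction X∈ (λ ())

saturate : ∀ {n} → List (Subset n) → Family n → Family n
saturate []       F = F
saturate (A ∷ As) F with intersecting? (insert A F)
... | yes _ = saturate As (insert A F)
... | no  _ = saturate As F

saturate-⊇ : ∀ {n} As (F : Family n) → F ⊆ᶠ saturate As F
saturate-⊇ []       F = λ _ X∈F → X∈F
saturate-⊇ (A ∷ As) F with intersecting? (insert A F)
... | yes _ = ⊆ᶠ-trans (insert-⊇ A F) (saturate-⊇ As (insert A F))
... | no  _ = saturate-⊇ As F

saturate-intersecting : ∀ {n} As {F : Family n} → Intersecting F → Intersecting (saturate As F)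
saturate-intersecting []       F-int = F-int
saturate-intersecting (A ∷ As) {F} F-int with intersecting? (insert A F)
... | yes F+A-int = saturate-intersecting As F+A-int
... | no  _       = saturate-intersecting As F-int

saturate-maximal : ∀ {n} As {F H : Family n} → Intersecting H → saturate As F ⊆ᶠ H →
                   ∀ {X} → X ∈ As → H X ≡ true → saturate As F X ≡ true
saturate-maximal (A ∷ As) {F} H-int sat⊆H X∈As X∈H with intersecting? (insert A F) | X∈As
... | yes _   | here refl   = saturate-⊇ As (insert A F) A (insert-∋ A F)
... | yes _   | there X∈As′ = saturate-maximal As H-int sat⊆H X∈As′ X∈H
... | no ¬int | here refl   =
  contradiction (intersecting-⊆ᶠ (insert-least (⊆ᶠ-trans (saturate-⊇ As F) sat⊆H) X∈H) H-int) ¬int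
... | no _    | there X∈As′ = saturate-maximal As H-int sat⊆H X∈As′ X∈H

maximal-extension : ∀ {n} {H : Family n} → Intersecting H →
                    Σ (Family n) λ F → MaximalIntersecting F × H ⊆ᶠ F
maximal-extension {n} {H} H-int =
  saturate (allSubsets n) H ,
  (saturate-intersecting (allSubsets n) H-int ,
   λ K K-int sat⊆K X X∈K → saturate-maximal (allSubsets n) K-int sat⊆K (∈-allSubsets X) X∈K) ,
  saturate-⊇ (allSubsets n) H

star-intersecting : ∀ {n} (G : Family n) a → Intersecting (star a G)
star-intersecting G a A B A∈S B∈S with G A | G B
... | true  | true  = a , x∈p∩q⁺ (lookup⇒[]= a A A∈S , lookup⇒[]= a B B∈S)
... | true  | false = contradiction B∈S (λ ())
... | false | _     = contradiction A∈S (λ ())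

maximal-star-largest : ∀ {n} {G : Family n} {a : Fin n} → SubsetClosed G →
                       (∀ b → χ G · embed (star b powerSet) ≤ χ G · embed (star a powerSet)) →
                       ∀ {H F : Family n} → H ⊆ᶠ G → H ⊆ᶠ F → Intersecting F → Decomposable F →
                       ∣ H ∣ᶠ ℕ.≤ ∣ star a G ∣ᶠ
maximal-star-largest {G = G} {a} G-closed a-maximal {H} {F} H⊆G H⊆F F-int F-decomposable =
  fromℕ-cancel-≤ (+-double-cancel-≤ (begin
    fromℕ ∣ H ∣ᶠ + fromℕ ∣ H ∣ᶠ
      ≤⟨ double-count-≤ H⊆G H⊆F F-int ⟩
    χ G · embed F + fromℕ ∣ G ∣ᶠ
      ≤⟨ ℚP.+-monoˡ-≤ _ (·-embed-≤ {F = F} (χ-antitone G-closed) F-decomposable a-maximal) ⟩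
    χ G · embed (star a powerSet) + fromℕ ∣ G ∣ᶠ
      ≡⟨ ·-embed-star G a ⟩
    fromℕ ∣ star a G ∣ᶠ + fromℕ ∣ star a G ∣ᶠ ∎))
  where open ℚP.≤-Reasoning

mainTheorem1 :
    (∀ (n : ℕ) → 1 ℕ.≤ n → ∀ (F : Family n) → MaximalIntersecting F → Decomposable F) →
    ∀ (n : ℕ) → 1 ℕ.≤ n → ∀ (G : Family n) → SubsetClosed G →
      Σ (Fin n) λ a →
        Intersecting (star a G) ×
        (∀ (H : Family n) → H ⊆ᶠ G → Intersecting H → ∣ H ∣ᶠ ℕ.≤ ∣ star a G ∣ᶠ)
mainTheorem1 decomposable n@(suc _) 1≤n G G-closed = a , star-intersecting G a , star-a-largest
  where
  ⟨G,S̄⟩ : Fin n → ℚ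
  ⟨G,S̄⟩ b = χ G · embed (star b powerSet)
  a : Fin n
  a = argmax ⟨G,S̄⟩ Fin.zero (allFin n)
  a-maximal : ∀ b → ⟨G,S̄⟩ b ≤ ⟨G,S̄⟩ a
  a-maximal b = All.lookup (f[xs]≤f[argmax] {f = ⟨G,S̄⟩} Fin.zero (allFin n)) (∈-allFin b)
  star-a-largest : ∀ H → H ⊆ᶠ G → Intersecting H → ∣ H ∣ᶠ ℕ.≤ ∣ star a G ∣ᶠ
  star-a-largest H H⊆G H-int =
    let F , F-maximal , H⊆F = maximal-extension H-int
    in maximal-star-largest G-closed a-maximal H⊆G H⊆F (proj₁ F-maximal) (decomposable n 1≤n F F-maximal)
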